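{- (1) For every $f\in\mathbb{F}_q[t]$ and every $a\in\mathbb{F}_q^*$, $S(af)=S(f)$. (2) For every nonzero $f\in\mathbb{F}_q[t]$, $S(f)\le t^{\deg f}$. (3) For every irreducible $f\in\mathbb{F}_q[t]$, $S(f)=t^{\deg f}$.
   Context: Let $\mathbb{F}_q$ be a finite field with $q$ elements ($q$ a prime power). Fix an enumeration $\mathbb{F}_q=\{a_0,a_1,\dots,a_{q-1}\}$ with $a_0=0$, $a_1=1$. Every nonzero $f\in\mathbb{F}_q[t]$ of degree $m$ is uniquely written $f=a_{i_0}+a_{i_1}t+\dots+a_{i_m}t^m$ with $0\le i_j\le q-1$, $a_{i_m}\neq 0$. Put $\delta(f)=i_0+i_1q+\dots+i_mq^m$ and $\delta(0)=0$. Order $\mathbb{F}_q[t]$ by: $f>g$ iff $\delta(f)>\delta(g)$ (and $f\ge g$ iff $f>g$ or $f=g$). For nonzero $f$, $f!=\prod_{g<f}(f-g)$ (product over all $g\in\mathbb{F}_q[t]$ with $g<f$), and $0!=1$. For nonzero $f$, $S(f)$ is the smallest $g$ (in this order) with $f\mid g!$; $S(0)=0$. -}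

module Defs where

open import Level using (0ℓ)
open import Data.Nat using (ℕ; zero; suc; _+_; _*_; _∸_; _≤_; _<_; _<ᵇ_)
open import Data.Fin using (Fin; toℕ) renaming (zero to fz; suc to fs)
open import Data.Fin.Properties using (_≟_)
open import Data.Bool using (Bool; true; false; not; _∧_; T)
open import Data.List using (List; []; _∷_; _++_; map; foldr; concatMap; filterᵇ; length; replicate; allFin; upTo)
open import Data.Product using (Σ; ∃; _×_; _,_)
open import Data.Sum using (_⊎_)
open import Relation.Nullary using (¬_; does)
open import Relation.Binary.PropositionalEquality using (_≡_; _≢_)
open import Algebra.Structures using (IsCommutativeRing)

-- A finite field F_q with q = 2 + k elements, together with the fixed
-- enumeration F_q = {a_0, ..., a_{q-1}}, a_0 = 0, a_1 = 1.
-- We take the carrier to be Fin q itself, with a_i := i (the element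
-- with index i); the enumeration conditions become 0# = 0, 1# = 1.
-- (Every finite field with such an enumeration is isomorphic to one of
-- these via i ↦ a_i.)

record FqField (k : ℕ) : Set where
  field
    _+F_ _*F_ : Fin (suc (suc k)) → Fin (suc (suc k)) → Fin (suc (suc k))
    -F_       : Fin (suc (suc k)) → Fin (suc (suc k))
    isCommutativeRing : IsCommutativeRing _≡_ _+F_ _*F_ -F_ fz (fs fz)
    inverse : ∀ x → x ≢ fz → ∃ λ y → x *F y ≡ fs fz

module FqPoly {k : ℕ} (F : FqField k) where
  open FqField F

  q : ℕ
  q = suc (suc k)

  Fq : Set
  Fq = Fin q

  0# 1# : Fq
  0# = fz
  1# = fs fz

  isZero : Fq → Bool
  isZero x = does (x ≟ 0#)

  -- Polynomials: coefficient lists c_0 ∷ c_1 ∷ ... ∷ c_m ∷ [] with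
  -- leading coefficient c_m ≠ 0; the zero polynomial is [].
  normalᵇ : List Fq → Bool
  normalᵇ []           = true
  normalᵇ (x ∷ [])     = not (isZero x)
  normalᵇ (x ∷ y ∷ ys) = normalᵇ (y ∷ ys)

  Normal : List Fq → Set
  Normal xs = T (normalᵇ xs)

  Poly : Set
  Poly = Σ (List Fq) Normal

  strip : List Fq → List Fq
  strip [] = []
  strip (x ∷ xs) with strip xs
  ... | []    = if0 (isZero x)
    where
      if0 : Bool → List Fq
      if0 true  = []
      if0 false = x ∷ []
  ... | r ∷ rs = x ∷ r ∷ rs

  addR : List Fq → List Fq → List Fq
  addR []       ys       = ys
  addR (x ∷ xs) []       = x ∷ xs
  addR (x ∷ xs) (y ∷ ys) = (x +F y) ∷ addR xs ys

  negR : List Fq → List Fq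
  negR = map -F_

  mulR : List Fq → List Fq → List Fq
  mulR []       ys = []
  mulR (x ∷ xs) ys = addR (map (x *F_) ys) (0# ∷ mulR xs ys)

  _⊕_ _⊖_ _⊗_ : List Fq → List Fq → List Fq
  f ⊕ g = strip (addR f g)
  f ⊖ g = strip (addR f (negR g))
  f ⊗ g = strip (mulR f g)

  one : List Fq
  one = 1# ∷ []

  _·_ : Fq → List Fq → List Fq
  a · f = (a ∷ []) ⊗ f

  tpow : ℕ → List Fq
  tpow n = replicate n 0# ++ (1# ∷ [])

  deg : List Fq → ℕ
  deg f = length f ∸ 1

  -- δ(f) = i_0 + i_1 q + ... + i_m q^m   (a_i = i)
  δ : List Fq → ℕ
  δ = foldr (λ c acc → toℕ c + q * acc) 0

  _≺_ _≼_ : List Fq → List Fq → Set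
  f ≺ g = δ f < δ g
  f ≼ g = δ f ≤ δ g

  _∣_ : List Fq → List Fq → Set
  f ∣ g = ∃ λ h → Normal h × (h ⊗ f ≡ g)

  IsUnit : List Fq → Set
  IsUnit u = ∃ λ v → Normal v × (u ⊗ v ≡ one)

  Irreducible : List Fq → Set
  Irreducible f = Normal f × f ≢ [] × ¬ IsUnit f
    × (∀ g h → Normal g → Normal h → g ⊗ h ≡ f → IsUnit g ⊎ IsUnit h)

  listsOfLength : ℕ → List (List Fq)
  listsOfLength zero    = [] ∷ []
  listsOfLength (suc n) = concatMap (λ x → map (x ∷_) (listsOfLength n)) (allFin q)

  listsUpTo : ℕ → List (List Fq)
  listsUpTo n = concatMap listsOfLength (upTo (suc n))

  -- all polynomials g with g < f (each exactly once; they all have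
  -- length ≤ length f since δ g < δ f)
  smaller : List Fq → List (List Fq)
  smaller f = filterᵇ (λ g → normalᵇ g ∧ (δ g <ᵇ δ f)) (listsUpTo (length f))

  -- f! = ∏_{g < f} (f - g); empty product for f = 0 gives 0! = 1
  fact : List Fq → List Fq
  fact f = foldr _⊗_ one (map (f ⊖_) (smaller f))

  -- IsS f g : "S(f) = g".  S(0) = 0; for f ≠ 0, S(f) is the smallest
  -- polynomial g (w.r.t. ≼) with f ∣ g!.
  IsS : List Fq → List Fq → Set
  IsS [] g = g ≡ []
  IsS (x ∷ xs) g = Normal g × ((x ∷ xs) ∣ fact g)
    × (∀ h → Normal h → (x ∷ xs) ∣ fact h → g ≼ h)

{-# OPTIONS --safe #-}
module Submission where

-- Polynomials are compared coefficientwise, which makes all coefficient lists a commutative ring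
-- in which divisibility by a polynomial of degree d is decidable by division with remainder.
-- (1) a·f and f are associates, so they divide the same factorials.
-- (2) If c is the inverse of the leading coefficient of f and d = deg f, then h = t^d - c f has
-- degree < d, so h < t^d and t^d - h = c f is a factor of (t^d)!; the least g with f ∣ g! is then
-- found by a finite search among the polynomials of length at most d + 1.
-- (3) If f is irreducible and h < t^d, every factor h - g of h! is nonzero of degree < d, hence
-- invertible modulo f by Euclid's algorithm, so f cannot divide h!.

open import Level using (0ℓ; _⊔_)
open import Data.Product using (∃; ∃₂; _×_; _,_; proj₁; proj₂)
open import Data.List using (List; []; _∷_; map; foldr; length; filter)
open import Data.List.Membership.Propositional using (_∈_; lose)
open import Data.List.Relation.Unary.Any using (here; there)
open import Data.List.Relation.Unary.All using (All; []; _∷_; tabulate)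
open import Algebra.Bundles using (CommutativeRing; AbelianGroup)
open import Algebra.Structures using (IsAbelianGroup)
import Algebra.Definitions.RawMagma
import Algebra.Properties.Ring
import Algebra.Properties.CommutativeSemigroup
import Algebra.Properties.CommutativeMagma.Divisibility
import Algebra.Properties.Semigroup.Divisibility
import Algebra.Properties.Magma.Divisibility
import Algebra.Solver.Ring.NaturalCoefficients.Default
import Relation.Binary.Reasoning.Setoid
import Relation.Binary.PropositionalEquality as ≡

module CommutativeRingDivisibility {c ℓ} (R : CommutativeRing c ℓ) where
  open CommutativeRing R renaming (refl to ≈-refl; sym to ≈-sym)
  open Algebra.Definitions.RawMagma *-rawMagma using (_∣_; _,_)
  open Algebra.Properties.CommutativeMagma.Divisibility *-commutativeMagma using (x∣xy)
  open Algebra.Properties.Semigroup.Divisibility *-semigroup using (x∣ʳy⇒x∣ʳzy)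
  open Algebra.Properties.Ring ring using (-‿distribˡ-*; \\-leftDividesʳ; //-rightDividesˡ; xyx⁻¹≈y; ⁻¹-anti-homo‿-)
  open Algebra.Solver.Ring.NaturalCoefficients.Default commutativeSemiring using (solve; _:=_; _:+_; _:*_)
  open Relation.Binary.Reasoning.Setoid setoid

  UnitModulo : Carrier → Carrier → Set (c ⊔ ℓ)
  UnitModulo f u = ∃₂ λ v w → v * u + w * f ≈ 1#

  unit⇒unitModulo : ∀ {f u v} → u * v ≈ 1# → UnitModulo f u
  unit⇒unitModulo {f} {u} {v} uv≈1 = v , 0# , (begin
    v * u + 0# * f  ≈⟨ +-cong (*-comm v u) (zeroˡ f) ⟩
    u * v + 0#      ≈⟨ +-identityʳ (u * v) ⟩
    u * v           ≈⟨ uv≈1 ⟩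
    1#              ∎)

  -- From v r + w f = 1 and r = f - s u.
  unitModulo-remainder : ∀ {f s u r} → f ≈ s * u + r → UnitModulo f r → UnitModulo f u
  unitModulo-remainder {f} {s} {u} {r} f≈su+r (v , w , bezout) = - (v * s) , v + w , (begin
    - (v * s) * u + (v + w) * f            ≈⟨ +-cong (≈-sym (-‿distribˡ-* (v * s) u)) (*-congˡ f≈su+r) ⟩
    - (v * s * u) + (v + w) * (s * u + r)  ≈⟨ +-congˡ (solve 5 (λ v w s u r → (v :+ w) :* (s :* u :+ r) := v :* s :* u :+ (v :* r :+ w :* (s :* u :+ r))) ≈-refl v w s u r) ⟩
    - (v * s * u) + (v * s * u + (v * r + w * (s * u + r)))  ≈⟨ \\-leftDividesʳ (v * s * u) _ ⟩
    v * r + w * (s * u + r)                ≈⟨ +-congˡ (*-congˡ (≈-sym f≈su+r)) ⟩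
    v * r + w * f                          ≈⟨ bezout ⟩
    1#                                     ∎)

  unitModulo-cancel : ∀ {f u p} → UnitModulo f u → f ∣ u * p → f ∣ p
  unitModulo-cancel {f} {u} {p} (v , w , bezout) (h , hf≈up) = v * h + w * p , (begin
    (v * h + w * p) * f      ≈⟨ solve 5 (λ v h w p f → (v :* h :+ w :* p) :* f := v :* (h :* f) :+ w :* f :* p) ≈-refl v h w p f ⟩
    v * (h * f) + w * f * p  ≈⟨ +-congʳ (*-congˡ hf≈up) ⟩
    v * (u * p) + w * f * p  ≈⟨ solve 5 (λ v u p w f → v :* (u :* p) :+ w :* f :* p := (v :* u :+ w :* f) :* p) ≈-refl v u p w f ⟩
    (v * u + w * f) * p      ≈⟨ *-congʳ bezout ⟩
    1# * p                   ≈⟨ *-identityˡ p ⟩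
    p                        ∎)

  product : List Carrier → Carrier
  product = foldr _*_ 1#

  ∈⇒∣product : ∀ {x xs} → x ∈ xs → x ∣ product xs
  ∈⇒∣product {xs = x ∷ xs} (here ≡.refl) = x∣xy x (product xs)
  ∈⇒∣product {xs = y ∷ xs} (there x∈xs) = x∣ʳy⇒x∣ʳzy y (∈⇒∣product x∈xs)

  unitsModulo-∣product⇒∣1 : ∀ {f} xs → All (UnitModulo f) xs → f ∣ product xs → f ∣ 1#
  unitsModulo-∣product⇒∣1 []       []       f∣1 = f∣1
  unitsModulo-∣product⇒∣1 (x ∷ xs) (u ∷ us) f∣x·xs = unitsModulo-∣product⇒∣1 xs us (unitModulo-cancel u f∣x·xs)

  unit*-divides : ∀ {s u v} → s * v ≈ 1# → s * u ∣ u
  unit*-divides {s} {u} {v} sv≈1 = v , (begin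
    v * (s * u)  ≈⟨ solve 3 (λ v s u → v :* (s :* u) := (s :* v) :* u) ≈-refl v s u ⟩
    (s * v) * u  ≈⟨ *-congʳ sv≈1 ⟩
    1# * u       ≈⟨ *-identityˡ u ⟩
    u            ∎)

  quotient-difference : ∀ {f x y r} → x * f ≈ y * f + r → (x - y) * f ≈ r
  quotient-difference {f} {x} {y} {r} xf≈yf+r = begin
    (x - y) * f           ≈⟨ distribʳ f x (- y) ⟩
    x * f + - y * f       ≈⟨ +-cong xf≈yf+r (≈-sym (-‿distribˡ-* y f)) ⟩
    y * f + r - y * f     ≈⟨ xyx⁻¹≈y (y * f) r ⟩
    r                     ∎

  x-[x-y]≈y : ∀ x y → x - (x - y) ≈ y
  x-[x-y]≈y x y = begin
    x - (x - y)  ≈⟨ +-congˡ (⁻¹-anti-homo‿- x y) ⟩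
    x + (y - x)  ≈⟨ +-comm x (y - x) ⟩
    y - x + x    ≈⟨ //-rightDividesˡ x y ⟩
    y            ∎

open import Defs
open import Data.Nat using (ℕ; zero; suc; _+_; _*_; _≤_; _<_; _<ᵇ_; z≤n; s≤s; _≤?_; _^_)
open import Data.Nat.Induction using (<-rec)
open import Data.Nat.Properties
  using (module ≤-Reasoning; ≤-refl; ≤-trans; <-≤-trans; ≤-<-trans; <⇒≤; ≰⇒>; ≤-pred; ≤∧≢⇒<;
         <-irrefl; <-trans; m≤n+m; n≤1+n; *-suc; *-zeroʳ; *-monoʳ-≤; +-monoˡ-<; ^-monoʳ-≤; <⇒<ᵇ; <ᵇ⇒<)
  renaming (_≟_ to _≟ℕ_)
open import Data.Fin using (toℕ) renaming (zero to fz; suc to fs)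
open import Data.Fin.Properties using (_≟_; toℕ<n)
open import Data.Bool using (T; not; _∧_)
open import Data.Bool.Properties using (T-∧)
open import Data.List.Membership.Propositional.Properties
  using (∈-concatMap⁺; ∈-map⁺; ∈-map⁻; ∈-allFin; ∈-upTo⁺; ∈-filter⁺; ∈-filter⁻)
open import Data.List.Relation.Unary.All.Properties using (all-filter)
open import Data.List.Extrema.Nat using (argmin; f[argmin]≤v⁺; f[argmin]≤f[⊤]; argmin-all)
open import Data.Sum using (_⊎_; inj₁; inj₂)
open import Data.Empty using (⊥-elim)
open import Data.Unit using (tt)
open import Function using (_∘_; case_of_; _⇔_; mk⇔; Equivalence)
open import Relation.Nullary using (¬_; Dec; yes; no)
open import Relation.Nullary.Decidable using (T?; _×-dec_; map′)
open import Relation.Binary.PropositionalEquality using (_≡_; _≢_; refl; sym; trans; cong; cong₂; subst; module ≡-Reasoning)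
open import Relation.Binary.Structures using (IsEquivalence)
open import Relation.Binary.Bundles using (Setoid)

module _ {k : ℕ} (F : FqField k) where
  open FqField F
  open FqPoly F

  Fq-commutativeRing : CommutativeRing 0ℓ 0ℓ
  Fq-commutativeRing = record
    { Carrier = Fq ; _≈_ = _≡_ ; _+_ = _+F_ ; _*_ = _*F_ ; -_ = -F_ ; 0# = 0# ; 1# = 1#
    ; isCommutativeRing = isCommutativeRing }

  private
    module 𝔽 = CommutativeRing Fq-commutativeRing
    module 𝔽-Properties = Algebra.Properties.Ring 𝔽.ring

  open 𝔽 using () renaming (_+_ to _+ᶠ_; _*_ to _*ᶠ_; -_ to -ᶠ_)

  *-nonzero : ∀ {a b} → a ≢ 0# → b ≢ 0# → a *ᶠ b ≢ 0#
  *-nonzero {a} {b} a≢0 b≢0 ab≡0 with inverse a a≢0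
  ... | a⁻¹ , aa⁻¹≡1 = b≢0 (begin
      b                ≡⟨ 𝔽.*-identityˡ b ⟨
      1# *ᶠ b          ≡⟨ cong (_*ᶠ b) (trans (𝔽.*-comm a⁻¹ a) aa⁻¹≡1) ⟨
      a⁻¹ *ᶠ a *ᶠ b    ≡⟨ 𝔽.*-assoc a⁻¹ a b ⟩
      a⁻¹ *ᶠ (a *ᶠ b)  ≡⟨ cong (a⁻¹ *ᶠ_) ab≡0 ⟩
      a⁻¹ *ᶠ 0#        ≡⟨ 𝔽.zeroʳ a⁻¹ ⟩
      0#               ∎)
    where open ≡-Reasoning

  -- The ring of coefficient lists

  coeff : List Fq → ℕ → Fq
  coeff []       _       = 0#
  coeff (x ∷ _)  zero    = x
  coeff (_ ∷ xs) (suc n) = coeff xs n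

  infix 4 _≐_
  record _≐_ (xs ys : List Fq) : Set where
    constructor coeffwise
    field coeff-≡ : ∀ n → coeff xs n ≡ coeff ys n
  open _≐_

  ≐-isEquivalence : IsEquivalence _≐_
  ≐-isEquivalence = record
    { refl  = coeffwise λ _ → refl
    ; sym   = λ p → coeffwise λ n → sym (coeff-≡ p n)
    ; trans = λ p q → coeffwise λ n → trans (coeff-≡ p n) (coeff-≡ q n)
    }

  open IsEquivalence ≐-isEquivalence using () renaming (refl to ≐-refl; sym to ≐-sym; trans to ≐-trans)

  ≐-setoid : Setoid 0ℓ 0ℓ
  ≐-setoid = record { isEquivalence = ≐-isEquivalence }

  ∷-cong : ∀ {x y a b} → x ≡ y → a ≐ b → (x ∷ a) ≐ (y ∷ b)
  ∷-cong x≡y a≐b = coeffwise λ { zero → x≡y ; (suc n) → coeff-≡ a≐b n }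

  scale : Fq → List Fq → List Fq
  scale a = map (a *ᶠ_)

  coeff-addR : ∀ xs ys n → coeff (addR xs ys) n ≡ coeff xs n +ᶠ coeff ys n
  coeff-addR []       _        _       = sym (𝔽.+-identityˡ _)
  coeff-addR (_ ∷ _)  []       _       = sym (𝔽.+-identityʳ _)
  coeff-addR (_ ∷ _)  (_ ∷ _)  zero    = refl
  coeff-addR (_ ∷ xs) (_ ∷ ys) (suc n) = coeff-addR xs ys n

  coeff-negR : ∀ xs n → coeff (negR xs) n ≡ -ᶠ coeff xs n
  coeff-negR []       _       = sym 𝔽-Properties.-0#≈0#
  coeff-negR (_ ∷ _)  zero    = refl
  coeff-negR (_ ∷ xs) (suc n) = coeff-negR xs n

  coeff-scale : ∀ a xs n → coeff (scale a xs) n ≡ a *ᶠ coeff xs n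
  coeff-scale a []       _       = sym (𝔽.zeroʳ a)
  coeff-scale _ (_ ∷ _)  zero    = refl
  coeff-scale a (_ ∷ xs) (suc n) = coeff-scale a xs n

  addR-cong : ∀ {a a' b b'} → a ≐ a' → b ≐ b' → addR a b ≐ addR a' b'
  addR-cong {a} {a'} {b} {b'} a≐a' b≐b' = coeffwise λ n → begin
      coeff (addR a b) n        ≡⟨ coeff-addR a b n ⟩
      coeff a n +ᶠ coeff b n    ≡⟨ cong₂ _+ᶠ_ (coeff-≡ a≐a' n) (coeff-≡ b≐b' n) ⟩
      coeff a' n +ᶠ coeff b' n  ≡⟨ coeff-addR a' b' n ⟨
      coeff (addR a' b') n      ∎
    where open ≡-Reasoning

  addR-congˡ : ∀ a {b b'} → b ≐ b' → addR a b ≐ addR a b'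
  addR-congˡ a = addR-cong {a} ≐-refl

  addR-assoc : ∀ a b c → addR (addR a b) c ≐ addR a (addR b c)
  addR-assoc a b c = coeffwise λ n → begin
      coeff (addR (addR a b) c) n               ≡⟨ trans (coeff-addR (addR a b) c n) (cong (_+ᶠ coeff c n) (coeff-addR a b n)) ⟩
      (coeff a n +ᶠ coeff b n) +ᶠ coeff c n     ≡⟨ 𝔽.+-assoc _ _ _ ⟩
      coeff a n +ᶠ (coeff b n +ᶠ coeff c n)     ≡⟨ trans (coeff-addR a (addR b c) n) (cong (coeff a n +ᶠ_) (coeff-addR b c n)) ⟨
      coeff (addR a (addR b c)) n               ∎
    where open ≡-Reasoning

  addR-comm : ∀ a b → addR a b ≐ addR b a
  addR-comm a b = coeffwise λ n → begin
      coeff (addR a b) n      ≡⟨ coeff-addR a b n ⟩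
      coeff a n +ᶠ coeff b n  ≡⟨ 𝔽.+-comm _ _ ⟩
      coeff b n +ᶠ coeff a n  ≡⟨ coeff-addR b a n ⟨
      coeff (addR b a) n      ∎
    where open ≡-Reasoning

  addR-identityʳ : ∀ a → addR a [] ≐ a
  addR-identityʳ a = coeffwise λ n → trans (coeff-addR a [] n) (𝔽.+-identityʳ _)

  addR-inverseˡ : ∀ a → addR (negR a) a ≐ []
  addR-inverseˡ a = coeffwise λ n → begin
      coeff (addR (negR a) a) n     ≡⟨ coeff-addR (negR a) a n ⟩
      coeff (negR a) n +ᶠ coeff a n ≡⟨ cong (_+ᶠ coeff a n) (coeff-negR a n) ⟩
      -ᶠ coeff a n +ᶠ coeff a n     ≡⟨ 𝔽.-‿inverseˡ _ ⟩
      0#                            ∎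
    where open ≡-Reasoning

  negR-cong : ∀ {a a'} → a ≐ a' → negR a ≐ negR a'
  negR-cong {a} {a'} a≐a' = coeffwise λ n →
    trans (coeff-negR a n) (trans (cong -ᶠ_ (coeff-≡ a≐a' n)) (sym (coeff-negR a' n)))

  addR-isAbelianGroup : IsAbelianGroup _≐_ addR [] negR
  addR-isAbelianGroup = record
    { isGroup = record
      { isMonoid = record
        { isSemigroup = record
          { isMagma = record { isEquivalence = ≐-isEquivalence ; ∙-cong = addR-cong }
          ; assoc   = addR-assoc }
        ; identity = (λ _ → ≐-refl) , addR-identityʳ }
      ; inverse = addR-inverseˡ , λ a → ≐-trans (addR-comm a (negR a)) (addR-inverseˡ a)
      ; ⁻¹-cong = negR-cong }
    ; comm = addR-comm }

  addR-abelianGroup : AbelianGroup 0ℓ 0ℓ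
  addR-abelianGroup = record { isAbelianGroup = addR-isAbelianGroup }

  open Algebra.Properties.CommutativeSemigroup (AbelianGroup.commutativeSemigroup addR-abelianGroup)
    using (interchange; x∙yz≈y∙xz)

  scale-cong : ∀ a {u u'} → u ≐ u' → scale a u ≐ scale a u'
  scale-cong a {u} {u'} u≐u' = coeffwise λ n →
    trans (coeff-scale a u n) (trans (cong (a *ᶠ_) (coeff-≡ u≐u' n)) (sym (coeff-scale a u' n)))

  scale-distrib : ∀ a u v → scale a (addR u v) ≐ addR (scale a u) (scale a v)
  scale-distrib a u v = coeffwise λ n → begin
      coeff (scale a (addR u v)) n                 ≡⟨ trans (coeff-scale a (addR u v) n) (cong (a *ᶠ_) (coeff-addR u v n)) ⟩
      a *ᶠ (coeff u n +ᶠ coeff v n)                ≡⟨ 𝔽.distribˡ a _ _ ⟩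
      a *ᶠ coeff u n +ᶠ a *ᶠ coeff v n             ≡⟨ trans (coeff-addR (scale a u) (scale a v) n) (cong₂ _+ᶠ_ (coeff-scale a u n) (coeff-scale a v n)) ⟨
      coeff (addR (scale a u) (scale a v)) n       ∎
    where open ≡-Reasoning

  scale-assoc : ∀ a b u → scale (a *ᶠ b) u ≐ scale a (scale b u)
  scale-assoc a b u = coeffwise λ n → begin
      coeff (scale (a *ᶠ b) u) n    ≡⟨ coeff-scale (a *ᶠ b) u n ⟩
      a *ᶠ b *ᶠ coeff u n           ≡⟨ 𝔽.*-assoc a b _ ⟩
      a *ᶠ (b *ᶠ coeff u n)         ≡⟨ trans (coeff-scale a (scale b u) n) (cong (a *ᶠ_) (coeff-scale b u n)) ⟨
      coeff (scale a (scale b u)) n ∎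
    where open ≡-Reasoning

  scale-identity : ∀ u → scale 1# u ≐ u
  scale-identity u = coeffwise λ n → trans (coeff-scale 1# u n) (𝔽.*-identityˡ _)

  scale-zero : ∀ u → scale 0# u ≐ []
  scale-zero u = coeffwise λ n → trans (coeff-scale 0# u n) (𝔽.zeroˡ _)

  shift-[] : ∀ {w} → w ≐ [] → (0# ∷ w) ≐ []
  shift-[] w≐[] = coeffwise λ { zero → refl ; (suc n) → coeff-≡ w≐[] n }

  shift-addR : ∀ u v → (0# ∷ addR u v) ≐ addR (0# ∷ u) (0# ∷ v)
  shift-addR u v = ∷-cong (sym (𝔽.+-identityˡ 0#)) ≐-refl

  scale-shift : ∀ a u → scale a (0# ∷ u) ≐ (0# ∷ scale a u)
  scale-shift a u = ∷-cong (𝔽.zeroʳ a) ≐-refl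

  -- mulR (x ∷ xs) ys is definitionally addR (scale x ys) (0# ∷ mulR xs ys).

  mulR-congˡ : ∀ xs {ys ys'} → ys ≐ ys' → mulR xs ys ≐ mulR xs ys'
  mulR-congˡ []       _       = ≐-refl
  mulR-congˡ (x ∷ xs) ys≐ys' = addR-cong (scale-cong x ys≐ys') (∷-cong refl (mulR-congˡ xs ys≐ys'))

  mulR-zeroʳ : ∀ xs → mulR xs [] ≐ []
  mulR-zeroʳ []       = ≐-refl
  mulR-zeroʳ (_ ∷ xs) = shift-[] (mulR-zeroʳ xs)

  mulR-∷ʳ : ∀ ys a xs → mulR ys (a ∷ xs) ≐ addR (scale a ys) (0# ∷ mulR ys xs)
  mulR-∷ʳ []       a xs = ≐-sym (shift-[] ≐-refl)
  mulR-∷ʳ (b ∷ ys) a xs = ∷-cong (cong (_+ᶠ 0#) (𝔽.*-comm b a)) (begin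
      addR (scale b xs) (mulR ys (a ∷ xs))                      ≈⟨ addR-cong ≐-refl (mulR-∷ʳ ys a xs) ⟩
      addR (scale b xs) (addR (scale a ys) (0# ∷ mulR ys xs))   ≈⟨ x∙yz≈y∙xz (scale b xs) (scale a ys) _ ⟩
      addR (scale a ys) (addR (scale b xs) (0# ∷ mulR ys xs))   ∎)
    where open Relation.Binary.Reasoning.Setoid ≐-setoid

  mulR-comm : ∀ xs ys → mulR xs ys ≐ mulR ys xs
  mulR-comm []       ys = ≐-sym (mulR-zeroʳ ys)
  mulR-comm (a ∷ xs) ys =
    ≐-trans (addR-cong ≐-refl (∷-cong refl (mulR-comm xs ys))) (≐-sym (mulR-∷ʳ ys a xs))

  mulR-congʳ : ∀ {xs xs'} ys → xs ≐ xs' → mulR xs ys ≐ mulR xs' ys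
  mulR-congʳ {xs} {xs'} ys xs≐xs' =
    ≐-trans (mulR-comm xs ys) (≐-trans (mulR-congˡ ys xs≐xs') (mulR-comm ys xs'))

  mulR-identityˡ : ∀ ys → mulR one ys ≐ ys
  mulR-identityˡ ys = ≐-trans (addR-cong (scale-identity ys) (shift-[] ≐-refl)) (addR-identityʳ ys)

  mulR-distribˡ : ∀ xs ys zs → mulR xs (addR ys zs) ≐ addR (mulR xs ys) (mulR xs zs)
  mulR-distribˡ []       ys zs = ≐-refl
  mulR-distribˡ (x ∷ xs) ys zs = begin
      addR (scale x (addR ys zs)) (0# ∷ mulR xs (addR ys zs))
        ≈⟨ addR-cong (scale-distrib x ys zs) (≐-trans (∷-cong refl (mulR-distribˡ xs ys zs)) (shift-addR (mulR xs ys) (mulR xs zs))) ⟩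
      addR (addR (scale x ys) (scale x zs)) (addR (0# ∷ mulR xs ys) (0# ∷ mulR xs zs))
        ≈⟨ interchange (scale x ys) (scale x zs) _ _ ⟩
      addR (addR (scale x ys) (0# ∷ mulR xs ys)) (addR (scale x zs) (0# ∷ mulR xs zs))
        ∎
    where open Relation.Binary.Reasoning.Setoid ≐-setoid

  mulR-distribʳ : ∀ xs ys zs → mulR (addR ys zs) xs ≐ addR (mulR ys xs) (mulR zs xs)
  mulR-distribʳ xs ys zs = ≐-trans (mulR-comm (addR ys zs) xs)
    (≐-trans (mulR-distribˡ xs ys zs) (addR-cong (mulR-comm xs ys) (mulR-comm xs zs)))

  mulR-scaleˡ : ∀ a ys zs → mulR (scale a ys) zs ≐ scale a (mulR ys zs)
  mulR-scaleˡ a []       zs = ≐-refl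
  mulR-scaleˡ a (b ∷ ys) zs = begin
      addR (scale (a *ᶠ b) zs) (0# ∷ mulR (scale a ys) zs)
        ≈⟨ addR-cong (scale-assoc a b zs) (∷-cong refl (mulR-scaleˡ a ys zs)) ⟩
      addR (scale a (scale b zs)) (0# ∷ scale a (mulR ys zs))
        ≈⟨ addR-cong ≐-refl (≐-sym (scale-shift a (mulR ys zs))) ⟩
      addR (scale a (scale b zs)) (scale a (0# ∷ mulR ys zs))
        ≈⟨ scale-distrib a (scale b zs) _ ⟨
      scale a (addR (scale b zs) (0# ∷ mulR ys zs))
        ∎
    where open Relation.Binary.Reasoning.Setoid ≐-setoid

  mulR-shiftˡ : ∀ w zs → mulR (0# ∷ w) zs ≐ (0# ∷ mulR w zs)
  mulR-shiftˡ w zs = addR-cong (scale-zero zs) ≐-refl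

  mulR-assoc : ∀ xs ys zs → mulR (mulR xs ys) zs ≐ mulR xs (mulR ys zs)
  mulR-assoc []       ys zs = ≐-refl
  mulR-assoc (a ∷ xs) ys zs = begin
      mulR (addR (scale a ys) (0# ∷ mulR xs ys)) zs
        ≈⟨ mulR-distribʳ zs (scale a ys) _ ⟩
      addR (mulR (scale a ys) zs) (mulR (0# ∷ mulR xs ys) zs)
        ≈⟨ addR-cong (mulR-scaleˡ a ys zs) (mulR-shiftˡ (mulR xs ys) zs) ⟩
      addR (scale a (mulR ys zs)) (0# ∷ mulR (mulR xs ys) zs)
        ≈⟨ addR-cong ≐-refl (∷-cong refl (mulR-assoc xs ys zs)) ⟩
      addR (scale a (mulR ys zs)) (0# ∷ mulR xs (mulR ys zs))
        ∎
    where open Relation.Binary.Reasoning.Setoid ≐-setoid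

  Fq[t] : CommutativeRing 0ℓ 0ℓ
  Fq[t] = record
    { Carrier = List Fq ; _≈_ = _≐_ ; _+_ = addR ; _*_ = mulR ; -_ = negR ; 0# = [] ; 1# = one
    ; isCommutativeRing = record
      { isRing = record
        { +-isAbelianGroup = addR-isAbelianGroup
        ; *-cong           = λ {x} {x'} {y} {y'} x≐x' y≐y' → ≐-trans (mulR-congʳ y x≐x') (mulR-congˡ x' y≐y')
        ; *-assoc          = mulR-assoc
        ; *-identity       = mulR-identityˡ , λ x → ≐-trans (mulR-comm x one) (mulR-identityˡ x)
        ; distrib          = mulR-distribˡ , mulR-distribʳ }
      ; *-comm = mulR-comm }
    }

  private
    module ℙ = CommutativeRing Fq[t]
    module ℙ-Properties = Algebra.Properties.Ring ℙ.ring
  open Algebra.Definitions.RawMagma ℙ.*-rawMagma using (_,_) renaming (_∣_ to _∣ₚ_)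
  open Algebra.Properties.Magma.Divisibility ℙ.*-magma using () renaming (∣ʳ-respʳ-≈ to ∣ₚ-respʳ; ∣ʳ-respˡ-≈ to ∣ₚ-respˡ)
  open Algebra.Properties.Semigroup.Divisibility ℙ.*-semigroup using () renaming (∣ʳ-trans to ∣ₚ-trans)

  -- Normal forms

  strip-≐ : ∀ xs → strip xs ≐ xs
  strip-≐ []       = ≐-refl
  strip-≐ (x ∷ xs) with strip xs | strip-≐ xs
  ... | _ ∷ _ | stripped≐xs = ∷-cong refl stripped≐xs
  ... | []    | []≐xs with x ≟ 0#
  ...   | yes x≡0 = coeffwise λ { zero → sym x≡0 ; (suc n) → coeff-≡ []≐xs n }
  ...   | no _    = ∷-cong refl []≐xs

  ≢0⇒nonzero : ∀ {x} → x ≢ 0# → T (not (isZero x))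
  ≢0⇒nonzero {x} x≢0 with x ≟ 0#
  ... | yes x≡0 = x≢0 x≡0
  ... | no _    = tt

  strip-normal : ∀ xs → Normal (strip xs)
  strip-normal []       = tt
  strip-normal (x ∷ xs) with strip xs | strip-normal xs
  ... | _ ∷ _ | normal = normal
  ... | []    | _ with x ≟ 0#
  ...   | yes _   = tt
  ...   | no x≢0  = ≢0⇒nonzero x≢0

  normal-tail : ∀ {x xs} → Normal (x ∷ xs) → Normal xs
  normal-tail {xs = []}    _      = tt
  normal-tail {xs = _ ∷ _} normal = normal

  normal-leading : ∀ y ys → Normal (y ∷ ys) → coeff (y ∷ ys) (length ys) ≢ 0#
  normal-leading y []       normal y≡0 with y ≟ 0#
  normal-leading y []       ()     y≡0 | yes _
  ... | no y≢0 = y≢0 y≡0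
  normal-leading _ (z ∷ zs) normal = normal-leading z zs normal

  normal-≐⇒≡ : ∀ {xs ys} → Normal xs → Normal ys → xs ≐ ys → xs ≡ ys
  normal-≐⇒≡ {[]}     {[]}     _  _  _     = refl
  normal-≐⇒≡ {[]}     {y ∷ ys} _  ny []≐ys = ⊥-elim (normal-leading y ys ny (sym (coeff-≡ []≐ys (length ys))))
  normal-≐⇒≡ {x ∷ xs} {[]}     nx _  xs≐[] = ⊥-elim (normal-leading x xs nx (coeff-≡ xs≐[] (length xs)))
  normal-≐⇒≡ {x ∷ xs} {y ∷ ys} nx ny xs≐ys =
    cong₂ _∷_ (coeff-≡ xs≐ys zero) (normal-≐⇒≡ (normal-tail {x} {xs} nx) (normal-tail {y} {ys} ny) (coeffwise (coeff-≡ xs≐ys ∘ suc)))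

  strip-cong : ∀ {xs ys} → xs ≐ ys → strip xs ≡ strip ys
  strip-cong {xs} {ys} xs≐ys = normal-≐⇒≡ (strip-normal xs) (strip-normal ys)
    (≐-trans (strip-≐ xs) (≐-trans xs≐ys (≐-sym (strip-≐ ys))))

  strip-of-normal : ∀ {xs} → Normal xs → strip xs ≡ xs
  strip-of-normal {xs} normal = normal-≐⇒≡ (strip-normal xs) normal (strip-≐ xs)

  -- Degrees

  record VanishesFrom (n : ℕ) (w : List Fq) : Set where
    constructor vanishesFrom
    field vanishes : ∀ m → n ≤ m → coeff w m ≡ 0#
  open VanishesFrom

  record HasDegree (w : List Fq) (d : ℕ) : Set where
    constructor hasDegree
    field
      above   : VanishesFrom (suc d) w
      leading : coeff w d ≢ 0#
  open HasDegree

  length-vanishesFrom : ∀ w → VanishesFrom (length w) w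
  length-vanishesFrom w = vanishesFrom (go w)
    where
      go : ∀ w m → length w ≤ m → coeff w m ≡ 0#
      go []      _       _         = refl
      go (_ ∷ w) (suc m) (s≤s n≤m) = go w m n≤m

  constant-hasDegree : ∀ {a} → a ≢ 0# → HasDegree (a ∷ []) 0
  constant-hasDegree a≢0 = hasDegree (vanishesFrom λ { (suc _) _ → refl }) a≢0

  normal-hasDegree : ∀ y ys → Normal (y ∷ ys) → HasDegree (y ∷ ys) (length ys)
  normal-hasDegree y ys normal = hasDegree (length-vanishesFrom (y ∷ ys)) (normal-leading y ys normal)

  vanishesFrom-resp : ∀ {n w w'} → w ≐ w' → VanishesFrom n w → VanishesFrom n w'
  vanishesFrom-resp w≐w' w-vanishes = vanishesFrom λ m n≤m → trans (sym (coeff-≡ w≐w' m)) (vanishes w-vanishes m n≤m)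

  hasDegree-resp : ∀ {d w w'} → w ≐ w' → HasDegree w d → HasDegree w' d
  hasDegree-resp {d} w≐w' w-deg =
    hasDegree (vanishesFrom-resp w≐w' (above w-deg)) (leading w-deg ∘ trans (coeff-≡ w≐w' d))

  hasDegree⇒≉[] : ∀ {w d} → HasDegree w d → ¬ w ≐ []
  hasDegree⇒≉[] {d = d} w-deg w≐[] = leading w-deg (coeff-≡ w≐[] d)

  hasDegree-vanishesFrom⇒< : ∀ {w d n} → HasDegree w d → VanishesFrom n w → d < n
  hasDegree-vanishesFrom⇒< {d = d} {n} w-deg w-vanishes with suc d ≤? n
  ... | yes d<n = d<n
  ... | no  d≮n = ⊥-elim (leading w-deg (vanishes w-vanishes d (≤-pred (≰⇒> d≮n))))

  normal-vanishesFrom⇒length≤ : ∀ {w n} → Normal w → VanishesFrom n w → length w ≤ n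
  normal-vanishesFrom⇒length≤ {[]}     _      _          = z≤n
  normal-vanishesFrom⇒length≤ {y ∷ ys} normal w-vanishes = hasDegree-vanishesFrom⇒< (normal-hasDegree y ys normal) w-vanishes

  ≐[]⊎hasDegree : ∀ w → w ≐ [] ⊎ ∃ (HasDegree w)
  ≐[]⊎hasDegree w with strip w | strip-≐ w | strip-normal w
  ... | []     | []≐w | _      = inj₁ (≐-sym []≐w)
  ... | y ∷ ys | s≐w  | normal = inj₂ (length ys , hasDegree-resp s≐w (normal-hasDegree y ys normal))

  coeff-mulR-∷ : ∀ x xs g n → coeff (mulR (x ∷ xs) g) n ≡ x *ᶠ coeff g n +ᶠ coeff (0# ∷ mulR xs g) n
  coeff-mulR-∷ x xs g n = trans (coeff-addR (scale x g) _ n) (cong (_+ᶠ _) (coeff-scale x g n))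

  leading-mulR : ∀ f g a b → VanishesFrom (suc a) f → VanishesFrom (suc b) g →
    coeff (mulR f g) (a + b) ≡ coeff f a *ᶠ coeff g b × VanishesFrom (suc (a + b)) (mulR f g)
  leading-mulR []       g a       b _  _  = sym (𝔽.zeroˡ _) , vanishesFrom λ _ _ → refl
  leading-mulR (x ∷ xs) g zero    b vf vg = top , vanishesFrom higher
    where
      xs·g≐[] : (0# ∷ mulR xs g) ≐ []
      xs·g≐[] = shift-[] (mulR-congʳ {xs} {[]} g (coeffwise λ m → vanishes vf (suc m) (s≤s z≤n)))
      top : coeff (mulR (x ∷ xs) g) b ≡ x *ᶠ coeff g b
      top = trans (coeff-mulR-∷ x xs g b) (trans (cong (_ +ᶠ_) (coeff-≡ xs·g≐[] b)) (𝔽.+-identityʳ _))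
      higher : ∀ m → suc b ≤ m → coeff (mulR (x ∷ xs) g) m ≡ 0#
      higher m b<m = trans (coeff-mulR-∷ x xs g m)
        (trans (cong₂ _+ᶠ_ (trans (cong (x *ᶠ_) (vanishes vg m b<m)) (𝔽.zeroʳ x)) (coeff-≡ xs·g≐[] m)) (𝔽.+-identityʳ 0#))
  leading-mulR (x ∷ xs) g (suc a) b vf vg = top , vanishesFrom higher
    where
      ih = leading-mulR xs g a b (vanishesFrom λ m a<m → vanishes vf (suc m) (s≤s a<m)) vg
      g-vanishes : ∀ m → a + b ≤ m → x *ᶠ coeff g (suc m) ≡ 0#
      g-vanishes m a+b≤m = trans (cong (x *ᶠ_) (vanishes vg (suc m) (s≤s (≤-trans (m≤n+m b a) a+b≤m)))) (𝔽.zeroʳ x)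
      top : coeff (mulR (x ∷ xs) g) (suc (a + b)) ≡ coeff xs a *ᶠ coeff g b
      top = trans (coeff-mulR-∷ x xs g (suc (a + b)))
        (trans (cong₂ _+ᶠ_ (g-vanishes (a + b) ≤-refl) (proj₁ ih)) (𝔽.+-identityˡ _))
      higher : ∀ m → suc (suc (a + b)) ≤ m → coeff (mulR (x ∷ xs) g) m ≡ 0#
      higher (suc m) (s≤s a+b<m) = trans (coeff-mulR-∷ x xs g (suc m))
        (trans (cong₂ _+ᶠ_ (g-vanishes m (≤-trans (n≤1+n _) a+b<m)) (vanishes (proj₂ ih) m a+b<m)) (𝔽.+-identityˡ 0#))

  hasDegree-mulR : ∀ {f g a b} → HasDegree f a → HasDegree g b → HasDegree (mulR f g) (a + b)
  hasDegree-mulR {f} {g} {a} {b} f-deg g-deg =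
    hasDegree (proj₂ top) (*-nonzero (leading f-deg) (leading g-deg) ∘ trans (sym (proj₁ top)))
    where top = leading-mulR f g a b (above f-deg) (above g-deg)

  ∣ₚ-vanishesFrom⇒≐[] : ∀ {f d g} → HasDegree f d → f ∣ₚ g → VanishesFrom d g → g ≐ []
  ∣ₚ-vanishesFrom⇒≐[] {f} {d} {g} f-deg (u , uf≐g) g-vanishes with ≐[]⊎hasDegree u
  ... | inj₁ u≐[]        = ≐-trans (≐-sym uf≐g) (mulR-congʳ f u≐[])
  ... | inj₂ (e , u-deg) = ⊥-elim (<-irrefl refl (≤-<-trans (m≤n+m d e)
          (hasDegree-vanishesFrom⇒< (hasDegree-resp uf≐g (hasDegree-mulR u-deg f-deg)) g-vanishes)))

  -- Division with remainder

  private module ℙ-Solver = Algebra.Solver.Ring.NaturalCoefficients.Default ℙ.commutativeSemiring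
  open CommutativeRingDivisibility Fq[t]

  t : List Fq
  t = 0# ∷ one

  ∷-as-sum : ∀ a w → (a ∷ w) ≐ addR (a ∷ []) (mulR t w)
  ∷-as-sum a w = ≐-trans (∷-cong (sym (𝔽.+-identityʳ a)) ≐-refl)
    (addR-congˡ (a ∷ []) (≐-sym (≐-trans (mulR-shiftˡ one w) (∷-cong refl (mulR-identityˡ w)))))

  coeff-constant-mulR : ∀ s f m → coeff (mulR (s ∷ []) f) m ≡ s *ᶠ coeff f m
  coeff-constant-mulR s f m =
    trans (coeff-mulR-∷ s [] f m) (trans (cong (s *ᶠ coeff f m +ᶠ_) (coeff-≡ (shift-[] ≐-refl) m)) (𝔽.+-identityʳ _))

  cancel-leading : ∀ {f d ρ} → HasDegree f d → VanishesFrom (suc d) ρ →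
    ∃ λ s → VanishesFrom d (addR ρ (negR (mulR (s ∷ []) f)))
  cancel-leading {f} {d} {ρ} f-deg ρ-vanishes with inverse (coeff f d) (leading f-deg)
  ... | ℓ⁻¹ , ℓℓ⁻¹≡1 = s , vanishesFrom r-vanishes
    where
      s = coeff ρ d *ᶠ ℓ⁻¹
      coeff-r : ∀ m → coeff (addR ρ (negR (mulR (s ∷ []) f))) m ≡ coeff ρ m +ᶠ -ᶠ (s *ᶠ coeff f m)
      coeff-r m = trans (coeff-addR ρ _ m)
        (cong (coeff ρ m +ᶠ_) (trans (coeff-negR (mulR (s ∷ []) f) m) (cong -ᶠ_ (coeff-constant-mulR s f m))))
      s·ℓ≡ρ-top : s *ᶠ coeff f d ≡ coeff ρ d
      s·ℓ≡ρ-top = begin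
          coeff ρ d *ᶠ ℓ⁻¹ *ᶠ coeff f d    ≡⟨ 𝔽.*-assoc _ ℓ⁻¹ _ ⟩
          coeff ρ d *ᶠ (ℓ⁻¹ *ᶠ coeff f d)  ≡⟨ cong (coeff ρ d *ᶠ_) (trans (𝔽.*-comm ℓ⁻¹ _) ℓℓ⁻¹≡1) ⟩
          coeff ρ d *ᶠ 1#                  ≡⟨ 𝔽.*-identityʳ _ ⟩
          coeff ρ d                        ∎
        where open ≡-Reasoning
      r-vanishes : ∀ m → d ≤ m → coeff (addR ρ (negR (mulR (s ∷ []) f))) m ≡ 0#
      r-vanishes m d≤m with m ≟ℕ d
      ... | yes refl = trans (coeff-r m) (trans (cong (λ x → coeff ρ m +ᶠ -ᶠ x) s·ℓ≡ρ-top) (𝔽.-‿inverseʳ _))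
      ... | no  m≢d  = trans (coeff-r m)
              (trans (cong₂ (λ x y → x +ᶠ -ᶠ (s *ᶠ y)) (vanishes ρ-vanishes m d<m) (vanishes (above f-deg) m d<m))
              (trans (cong (λ x → 0# +ᶠ -ᶠ x) (𝔽.zeroʳ s)) (trans (𝔽.+-identityˡ _) 𝔽-Properties.-0#≈0#)))
        where d<m = ≤∧≢⇒< d≤m (m≢d ∘ sym)

  -- a ∷ g = a + t g = (t Q + s) f + ((a ∷ r) - s f), with s given by cancel-leading.
  divide : ∀ {f d} → HasDegree f d → ∀ g → ∃₂ λ Q r → g ≐ addR (mulR Q f) r × VanishesFrom d r
  divide f-deg [] = [] , [] , ≐-refl , vanishesFrom λ _ _ → refl
  divide {f} {d} f-deg (a ∷ g) with divide f-deg g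
  ... | Q , r , g≐Qf+r , r-vanishes with cancel-leading f-deg (vanishesFrom a∷r-vanishes)
    where
      a∷r-vanishes : ∀ m → suc d ≤ m → coeff (a ∷ r) m ≡ 0#
      a∷r-vanishes (suc m) (s≤s d≤m) = vanishes r-vanishes m d≤m
  ...   | s , r'-vanishes = addR (mulR t Q) S , addR (a ∷ r) (negR (mulR S f)) , a∷g≐Q'f+r' , r'-vanishes
    where
      open Relation.Binary.Reasoning.Setoid ≐-setoid
      open ℙ-Solver using (solve; _:=_; _:+_; _:*_)
      S = s ∷ []
      A = a ∷ []
      a∷g≐Q'f+r' : (a ∷ g) ≐ addR (mulR (addR (mulR t Q) S) f) (addR (a ∷ r) (negR (mulR S f)))
      a∷g≐Q'f+r' = begin
          a ∷ g
            ≈⟨ ≐-trans (∷-as-sum a g) (addR-congˡ A (mulR-congˡ t g≐Qf+r)) ⟩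
          addR A (mulR t (addR (mulR Q f) r))
            ≈⟨ addR-identityʳ _ ⟨
          addR (addR A (mulR t (addR (mulR Q f) r))) []
            ≈⟨ addR-congˡ (addR A (mulR t (addR (mulR Q f) r))) (ℙ.-‿inverseʳ (mulR S f)) ⟨
          addR (addR A (mulR t (addR (mulR Q f) r))) (addR (mulR S f) (negR (mulR S f)))
            ≈⟨ solve 7 (λ A T Q F R S N → A :+ T :* (Q :* F :+ R) :+ (S :* F :+ N) := (T :* Q :+ S) :* F :+ (A :+ T :* R :+ N))
                 ≐-refl A t Q f r S (negR (mulR S f)) ⟩
          addR (mulR (addR (mulR t Q) S) f) (addR (addR A (mulR t r)) (negR (mulR S f)))
            ≈⟨ addR-congˡ (mulR (addR (mulR t Q) S) f) (addR-cong (∷-as-sum a r) ≐-refl) ⟨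
          addR (mulR (addR (mulR t Q) S) f) (addR (a ∷ r) (negR (mulR S f)))
            ∎

  ∣ₚ? : ∀ {f d} → HasDegree f d → ∀ g → Dec (f ∣ₚ g)
  ∣ₚ? {f} f-deg g with divide f-deg g
  ... | Q , r , g≐Qf+r , r-vanishes with ≐[]⊎hasDegree r
  ...   | inj₁ r≐[]        = yes (Q , ≐-sym (≐-trans g≐Qf+r (≐-trans (addR-congˡ (mulR Q f) r≐[]) (addR-identityʳ (mulR Q f)))))
  ...   | inj₂ (_ , r-deg) = no λ f∣g → hasDegree⇒≉[] r-deg (∣ₚ-vanishesFrom⇒≐[] f-deg (f∣r f∣g) r-vanishes)
    where
      f∣r : f ∣ₚ g → f ∣ₚ r
      f∣r (h , hf≐g) = addR h (negR Q) , quotient-difference {f} {h} {Q} (≐-trans hf≐g g≐Qf+r)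

  -- Divisibility of factorials

  ≡⇒≐ : ∀ {xs ys} → xs ≡ ys → xs ≐ ys
  ≡⇒≐ refl = ≐-refl

  ⊗-≐ : ∀ f g → f ⊗ g ≐ mulR f g
  ⊗-≐ f g = strip-≐ (mulR f g)

  ∣⇒∣ₚ : ∀ {f g} → f ∣ g → f ∣ₚ g
  ∣⇒∣ₚ {f} (h , _ , h⊗f≡g) = h , ≐-trans (≐-sym (⊗-≐ h f)) (≡⇒≐ h⊗f≡g)

  ∣ₚ⇒∣ : ∀ {f g} → Normal g → f ∣ₚ g → f ∣ g
  ∣ₚ⇒∣ {f} normal (h , hf≐g) =
    strip h , strip-normal h , trans (strip-cong (≐-trans (mulR-congʳ f (strip-≐ h)) hf≐g)) (strip-of-normal normal)

  isUnit⇒unit : ∀ {u} → IsUnit u → ∃ λ v → mulR u v ≐ one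
  isUnit⇒unit {u} (v , _ , u⊗v≡one) = v , ≐-trans (≐-sym (⊗-≐ u v)) (≡⇒≐ u⊗v≡one)

  ∣ₚone⇒isUnit : ∀ {f} → f ∣ₚ one → IsUnit f
  ∣ₚone⇒isUnit {f} (h , hf≐one) =
    strip h , strip-normal h , strip-cong (≐-trans (mulR-congˡ f (strip-≐ h)) (≐-trans (mulR-comm f h) hf≐one))

  factors : List Fq → List (List Fq)
  factors h = map (h ⊖_) (smaller h)

  fact-≐ : ∀ h → fact h ≐ product (factors h)
  fact-≐ h = go (factors h)
    where
      go : ∀ L → foldr _⊗_ one L ≐ product L
      go []      = ≐-refl
      go (x ∷ L) = ≐-trans (⊗-≐ x _) (mulR-congˡ x (go L))

  fact-normal : ∀ h → Normal (fact h)
  fact-normal h with factors h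
  ... | []    = tt
  ... | x ∷ L = strip-normal (mulR x (foldr _⊗_ one L))

  ∣fact⇔∣ₚproduct : ∀ {f} h → (f ∣ fact h) ⇔ (f ∣ₚ product (factors h))
  ∣fact⇔∣ₚproduct h = mk⇔
    (λ f∣fact → ∣ₚ-respʳ (fact-≐ h) (∣⇒∣ₚ f∣fact))
    (λ f∣product → ∣ₚ⇒∣ (fact-normal h) (∣ₚ-respʳ (≐-sym (fact-≐ h)) f∣product))

  ∣fact? : ∀ {f d} → HasDegree f d → ∀ h → Dec (f ∣ fact h)
  ∣fact? f-deg h = map′ from to (∣ₚ? f-deg (product (factors h)))
    where open Equivalence (∣fact⇔∣ₚproduct h)

  -- The order and the search for S(f)

  δ<q^length : ∀ xs → δ xs < q ^ length xs
  δ<q^length []       = s≤s z≤n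
  δ<q^length (x ∷ xs) = begin-strict
      toℕ x + q * δ xs  <⟨ +-monoˡ-< (q * δ xs) (toℕ<n x) ⟩
      q + q * δ xs      ≡⟨ *-suc q (δ xs) ⟨
      q * suc (δ xs)    ≤⟨ *-monoʳ-≤ q (δ<q^length xs) ⟩
      q * q ^ length xs ∎
    where open ≤-Reasoning

  normal⇒q^deg≤δ : ∀ y ys → Normal (y ∷ ys) → q ^ length ys ≤ δ (y ∷ ys)
  normal⇒q^deg≤δ fz     []       ()
  normal⇒q^deg≤δ (fs _) []       _      = s≤s z≤n
  normal⇒q^deg≤δ y      (z ∷ zs) normal =
    ≤-trans (*-monoʳ-≤ q (normal⇒q^deg≤δ z zs normal)) (m≤n+m (q * δ (z ∷ zs)) (toℕ y))

  length≤⇒δ<q^ : ∀ h d → length h ≤ d → δ h < q ^ d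
  length≤⇒δ<q^ h d length≤d = <-≤-trans (δ<q^length h) (^-monoʳ-≤ q length≤d)

  δ<q^⇒length≤ : ∀ h d → Normal h → δ h < q ^ d → length h ≤ d
  δ<q^⇒length≤ []       d _      _      = z≤n
  δ<q^⇒length≤ (y ∷ ys) d normal δ<q^d with suc (length ys) ≤? d
  ... | yes length≤d = length≤d
  ... | no  length≰d = ⊥-elim (<-irrefl refl (<-≤-trans δ<q^d
          (≤-trans (^-monoʳ-≤ q (≤-pred (≰⇒> length≰d))) (normal⇒q^deg≤δ y ys normal))))

  δ-tpow : ∀ d → δ (tpow d) ≡ q ^ d
  δ-tpow zero    = cong suc (*-zeroʳ q)
  δ-tpow (suc d) = cong (q *_) (δ-tpow d)

  length-tpow : ∀ d → length (tpow d) ≡ suc d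
  length-tpow zero    = refl
  length-tpow (suc d) = cong suc (length-tpow d)

  tpow-vanishesFrom : ∀ d → VanishesFrom (suc d) (tpow d)
  tpow-vanishesFrom d = subst (λ n → VanishesFrom n (tpow d)) (length-tpow d) (length-vanishesFrom (tpow d))

  normal-tpow : ∀ d → Normal (tpow d)
  normal-tpow zero          = tt
  normal-tpow (suc zero)    = tt
  normal-tpow (suc (suc d)) = normal-tpow (suc d)

  ∈-listsOfLength : ∀ xs → xs ∈ listsOfLength (length xs)
  ∈-listsOfLength []       = here refl
  ∈-listsOfLength (x ∷ xs) =
    ∈-concatMap⁺ (λ y → map (y ∷_) (listsOfLength (length xs))) (lose (∈-allFin x) (∈-map⁺ (x ∷_) (∈-listsOfLength xs)))

  ∈-listsUpTo : ∀ xs n → length xs ≤ n → xs ∈ listsUpTo n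
  ∈-listsUpTo xs n length≤n = ∈-concatMap⁺ listsOfLength (lose (∈-upTo⁺ (s≤s length≤n)) (∈-listsOfLength xs))

  ∈-smaller⁺ : ∀ {w h} → Normal w → δ w < δ h → length w ≤ length h → w ∈ smaller h
  ∈-smaller⁺ {w} {h} normal δw<δh length≤ =
    ∈-filter⁺ (T? ∘ λ g → normalᵇ g ∧ (δ g <ᵇ δ h)) (∈-listsUpTo w (length h) length≤)
      (Equivalence.from T-∧ (normal , <⇒<ᵇ δw<δh))

  ∈-smaller⁻ : ∀ {w h} → w ∈ smaller h → Normal w × δ w < δ h
  ∈-smaller⁻ {w} {h} w∈smaller
    with Equivalence.to T-∧ (proj₂ (∈-filter⁻ (T? ∘ λ g → normalᵇ g ∧ (δ g <ᵇ δ h)) {xs = listsUpTo (length h)} w∈smaller))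
  ... | normal , δw<ᵇδh = normal , <ᵇ⇒< (δ w) (δ h) δw<ᵇδh

  length<⇒δ< : ∀ g h → Normal h → length g < length h → δ g < δ h
  length<⇒δ< g (y ∷ ys) normal (s≤s length≤) =
    <-≤-trans (length≤⇒δ<q^ g _ length≤) (normal⇒q^deg≤δ y ys normal)

  -- The least element is searched among the finitely many polynomials no longer than g₀;
  -- longer ones are larger than g₀ anyway.
  least-δ : (P : List Fq → Set) → (∀ h → Dec (P h)) → (∀ {h} → P h → Normal h) →
    ∀ {g₀} → P g₀ → ∃ λ g → P g × g ≼ g₀ × (∀ h → P h → g ≼ h)
  least-δ P P? P⇒normal {g₀} Pg₀ = g , Pg , f[argmin]≤f[⊤] {f = δ} g₀ candidates , minimal
    where
      candidates : List (List Fq)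
      candidates = filter P? (listsUpTo (length g₀))
      g : List Fq
      g = argmin δ g₀ candidates
      Pg : P g
      Pg = argmin-all δ Pg₀ (all-filter P? (listsUpTo (length g₀)))
      minimal : ∀ h → P h → g ≼ h
      minimal h Ph with length h ≤? length g₀
      ... | yes length≤ = f[argmin]≤v⁺ {f = δ} g₀ candidates (inj₂ (lose (∈-filter⁺ P? (∈-listsUpTo h _ length≤) Ph) ≤-refl))
      ... | no  length≰ = <⇒≤ (≤-<-trans (f[argmin]≤f[⊤] {f = δ} g₀ candidates) (length<⇒δ< g₀ h (P⇒normal Ph) (≰⇒> length≰)))

  least-∣fact : ∀ x xs g₀ → Normal (x ∷ xs) → Normal g₀ → (x ∷ xs) ∣ fact g₀ →
    ∃ λ g → IsS (x ∷ xs) g × g ≼ g₀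
  least-∣fact x xs g₀ normal normal₀ f∣g₀! = result (least-δ P P? proj₁ {g₀} (normal₀ , f∣g₀!))
    where
      P : List Fq → Set
      P h = Normal h × (x ∷ xs) ∣ fact h
      P? : ∀ h → Dec (P h)
      P? h = T? (normalᵇ h) ×-dec ∣fact? (normal-hasDegree x xs normal) h
      result : (∃ λ g → P g × g ≼ g₀ × (∀ h → P h → g ≼ h)) → ∃ λ g → IsS (x ∷ xs) g × g ≼ g₀
      result (g , (normal-g , f∣g!) , g≼g₀ , minimal) =
        g , (normal-g , f∣g! , λ h normal-h f∣h! → minimal h (normal-h , f∣h!)) , g≼g₀

  -- h := t^d - c·f with c = 1/lead(f) has degree < d, so t^d - h = c·f is a factor of (t^d)!.
  ∣fact-tpow : ∀ x xs → Normal (x ∷ xs) → (x ∷ xs) ∣ fact (tpow (length xs))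
  ∣fact-tpow x xs normal = Equivalence.from (∣fact⇔∣ₚproduct tᵈ) (∣ₚ-trans f∣tᵈ⊖h (∈⇒∣product tᵈ⊖h∈factors))
    where
      f = x ∷ xs
      d = length xs
      tᵈ = tpow d
      reduction = cancel-leading (normal-hasDegree x xs normal) (tpow-vanishesFrom d)
      c = proj₁ reduction
      h₀ = addR tᵈ (negR (mulR (c ∷ []) f))
      h = strip h₀
      length-h≤d : length h ≤ d
      length-h≤d = normal-vanishesFrom⇒length≤ (strip-normal h₀) (vanishesFrom-resp (≐-sym (strip-≐ h₀)) (proj₂ reduction))
      tᵈ⊖h∈factors : (tᵈ ⊖ h) ∈ factors tᵈ
      tᵈ⊖h∈factors = ∈-map⁺ (tᵈ ⊖_) (∈-smaller⁺ {h} {tᵈ} (strip-normal h₀)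
        (subst (δ h <_) (sym (δ-tpow d)) (length≤⇒δ<q^ h d length-h≤d))
        (subst (length h ≤_) (sym (length-tpow d)) (≤-trans length-h≤d (n≤1+n d))))
      f∣tᵈ⊖h : f ∣ₚ (tᵈ ⊖ h)
      f∣tᵈ⊖h = c ∷ [] , (begin
          mulR (c ∷ []) f                                   ≈⟨ x-[x-y]≈y tᵈ (mulR (c ∷ []) f) ⟨
          addR tᵈ (negR h₀)                                  ≈⟨ addR-congˡ tᵈ (negR-cong (strip-≐ h₀)) ⟨
          addR tᵈ (negR h)                                  ≈⟨ strip-≐ (addR tᵈ (negR h)) ⟨
          tᵈ ⊖ h                                            ∎)
        where open Relation.Binary.Reasoning.Setoid ≐-setoid

  S≼tpow-deg : ∀ f → Normal f → f ≢ [] → ∃ λ g → IsS f g × g ≼ tpow (deg f)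
  S≼tpow-deg []       _      []≢[] = ⊥-elim ([]≢[] refl)
  S≼tpow-deg (x ∷ xs) normal _     = least-∣fact x xs (tpow (length xs)) normal (normal-tpow (length xs)) (∣fact-tpow x xs normal)

  IsS-transfer : ∀ {x xs} f' {g} → f' ≢ [] → (x ∷ xs) ∣ₚ f' → f' ∣ₚ (x ∷ xs) → IsS (x ∷ xs) g → IsS f' g
  IsS-transfer []       []≢[] _     _     _                          = ⊥-elim ([]≢[] refl)
  IsS-transfer (_ ∷ _) {g} _    f∣f' f'∣f (normal , f∣g! , minimal) =
    normal , transfer g f'∣f f∣g! , λ h normal-h f'∣h! → minimal h normal-h (transfer h f∣f' f'∣h!)
    where
      transfer : ∀ {u v} h → u ∣ₚ v → v ∣ fact h → u ∣ fact h
      transfer h u∣v v∣h! = ∣ₚ⇒∣ (fact-normal h) (∣ₚ-trans u∣v (∣⇒∣ₚ v∣h!))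

  S-scale : ∀ f → Normal f → ∀ a → a ≢ 0# → ∃ λ g → IsS f g × IsS (a · f) g
  S-scale []       _      _ _   = [] , refl , refl
  S-scale (x ∷ xs) normal a a≢0 = g , S , IsS-transfer (a · f) {g} a·f≢[] f∣a·f a·f∣f S
    where
      f = x ∷ xs
      least = S≼tpow-deg f normal (λ ())
      g = proj₁ least
      S = proj₁ (proj₂ least)
      a⁻¹ = proj₁ (inverse a a≢0)
      a·f≐ : a · f ≐ mulR (a ∷ []) f
      a·f≐ = ⊗-≐ (a ∷ []) f
      a·f≢[] : a · f ≢ []
      a·f≢[] a·f≡[] = hasDegree⇒≉[] (hasDegree-mulR (constant-hasDegree a≢0) (normal-hasDegree x xs normal))
        (≐-trans (≐-sym a·f≐) (≡⇒≐ a·f≡[]))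
      f∣a·f : f ∣ₚ (a · f)
      f∣a·f = a ∷ [] , ≐-sym a·f≐
      a·f∣f : (a · f) ∣ₚ f
      a·f∣f = ∣ₚ-respˡ (≐-sym a·f≐)
        (unit*-divides {a ∷ []} {f} {a⁻¹ ∷ []} (∷-cong (trans (𝔽.+-identityʳ _) (proj₂ (inverse a a≢0))) ≐-refl))

  -- Irreducible polynomials

  vanishesFrom-mono : ∀ {m n w} → m ≤ n → VanishesFrom m w → VanishesFrom n w
  vanishesFrom-mono m≤n w-vanishes = vanishesFrom λ j n≤j → vanishes w-vanishes j (≤-trans m≤n n≤j)

  vanishesFrom-⊖ : ∀ {n a b} → VanishesFrom n a → VanishesFrom n b → VanishesFrom n (a ⊖ b)
  vanishesFrom-⊖ {n} {a} {b} a-vanishes b-vanishes = vanishesFrom-resp (≐-sym (strip-≐ (addR a (negR b)))) (vanishesFrom λ m n≤m → begin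
      coeff (addR a (negR b)) m        ≡⟨ trans (coeff-addR a (negR b) m) (cong (coeff a m +ᶠ_) (coeff-negR b m)) ⟩
      coeff a m +ᶠ -ᶠ coeff b m        ≡⟨ cong₂ (λ x y → x +ᶠ -ᶠ y) (vanishes a-vanishes m n≤m) (vanishes b-vanishes m n≤m) ⟩
      0# +ᶠ -ᶠ 0#                      ≡⟨ trans (𝔽.+-identityˡ _) 𝔽-Properties.-0#≈0# ⟩
      0#                               ∎)
    where open ≡-Reasoning

  -- If f = s u is irreducible and deg u < deg f, then s cannot be the unit, so u is one.
  irreducible-factor⇒unitModulo : ∀ {f d s u e} → Irreducible f → HasDegree f d → HasDegree u e → e < d →
    f ≐ mulR s u → UnitModulo f u
  irreducible-factor⇒unitModulo {f} {d} {s} {u} (normal , _ , _ , split) f-deg u-deg e<d f≐su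
    with split (strip s) (strip u) (strip-normal s) (strip-normal u) s⊗u≡f
    where
      s⊗u≡f : strip s ⊗ strip u ≡ f
      s⊗u≡f = trans (strip-cong (≐-trans (ℙ.*-cong (strip-≐ s) (strip-≐ u)) (≐-sym f≐su))) (strip-of-normal normal)
  ... | inj₂ u-unit = unit⇒unitModulo {f} {u} {v} (≐-trans (mulR-congʳ v (≐-sym (strip-≐ u))) uv≐one)
    where
      v = proj₁ (isUnit⇒unit {strip u} u-unit)
      uv≐one = proj₂ (isUnit⇒unit {strip u} u-unit)
  ... | inj₁ s-unit = ⊥-elim (hasDegree⇒≉[] u-deg (∣ₚ-vanishesFrom⇒≐[] f-deg f∣u (vanishesFrom-mono e<d (above u-deg))))
    where
      v = proj₁ (isUnit⇒unit {strip s} s-unit)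
      f∣u : f ∣ₚ u
      f∣u = ∣ₚ-respˡ (≐-sym f≐su) (unit*-divides {s} {u} {v} (≐-trans (mulR-congʳ v (≐-sym (strip-≐ s))) (proj₂ (isUnit⇒unit {strip s} s-unit))))

  -- Euclid's algorithm: divide f by u and recurse on the remainder, whose degree is smaller.
  irreducible⇒unitModulo : ∀ {f d} → Irreducible f → HasDegree f d →
    ∀ e {u} → HasDegree u e → e < d → UnitModulo f u
  irreducible⇒unitModulo {f} {d} irreducible f-deg = <-rec _ step
    where
      step : ∀ e → (∀ {e'} → e' < e → ∀ {u} → HasDegree u e' → e' < d → UnitModulo f u) →
             ∀ {u} → HasDegree u e → e < d → UnitModulo f u
      step e rec {u} u-deg e<d with divide u-deg f
      ... | s , r , f≐su+r , r-vanishes with ≐[]⊎hasDegree r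
      ...   | inj₂ (e' , r-deg) = unitModulo-remainder {f} {s} {u} {r} f≐su+r (rec e'<e r-deg (<-trans e'<e e<d))
        where e'<e = hasDegree-vanishesFrom⇒< r-deg r-vanishes
      ...   | inj₁ r≐[] = irreducible-factor⇒unitModulo {s = s} irreducible f-deg u-deg e<d
                (≐-trans f≐su+r (≐-trans (addR-congˡ (mulR s u) r≐[]) (addR-identityʳ (mulR s u))))

  -- Every factor h - w of h! with h < t^d is nonzero of degree < d, hence invertible modulo f.
  factors-unitModulo : ∀ {f d} → Irreducible f → HasDegree f d →
    ∀ h → Normal h → δ h < q ^ d → All (UnitModulo f) (factors h)
  factors-unitModulo {f} {d} irreducible f-deg h normal-h δh<q^d =
    tabulate λ u∈factors → case ∈-map⁻ (h ⊖_) u∈factors of λ { (w , w∈smaller , refl) → factor-unitModulo w w∈smaller }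
    where
      short-vanishesFrom : ∀ {w} → Normal w → δ w < q ^ d → VanishesFrom d w
      short-vanishesFrom {w} normal-w δw<q^d = vanishesFrom-mono (δ<q^⇒length≤ w d normal-w δw<q^d) (length-vanishesFrom w)
      factor-unitModulo : ∀ w → w ∈ smaller h → UnitModulo f (h ⊖ w)
      factor-unitModulo w w∈smaller with ∈-smaller⁻ {w} {h} w∈smaller | ≐[]⊎hasDegree (h ⊖ w)
      ... | normal-w , δw<δh | inj₁ h⊖w≐[] = ⊥-elim (<-irrefl (cong δ w≡h) δw<δh)
        where
          w≡h : w ≡ h
          w≡h = normal-≐⇒≡ normal-w normal-h (≐-sym (ℙ-Properties.x∙y⁻¹≈ε⇒x≈y h w (≐-trans (≐-sym (strip-≐ (addR h (negR w)))) h⊖w≐[])))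
      ... | normal-w , δw<δh | inj₂ (e , h⊖w-deg) = irreducible⇒unitModulo irreducible f-deg e h⊖w-deg
              (hasDegree-vanishesFrom⇒< h⊖w-deg (vanishesFrom-⊖ {d} {h} {w} (short-vanishesFrom normal-h δh<q^d)
                                                             (short-vanishesFrom normal-w (<-trans δw<δh δh<q^d))))

  S-irreducible : ∀ f → Irreducible f → IsS f (tpow (deg f))
  S-irreducible []       (_ , []≢[] , _) = ⊥-elim ([]≢[] refl)
  S-irreducible (x ∷ xs) irreducible@(normal , _ , not-unit , _) = normal-tpow d , ∣fact-tpow x xs normal , minimal
    where
      d = length xs
      minimal : ∀ h → Normal h → (x ∷ xs) ∣ fact h → tpow d ≼ h
      minimal h normal-h f∣h! with q ^ d ≤? δ h
      ... | yes q^d≤δh = subst (_≤ δ h) (sym (δ-tpow d)) q^d≤δh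
      ... | no  q^d≰δh = ⊥-elim (not-unit (∣ₚone⇒isUnit (unitsModulo-∣product⇒∣1 (factors h)
              (factors-unitModulo irreducible (normal-hasDegree x xs normal) h normal-h (≰⇒> q^d≰δh))
              (Equivalence.to (∣fact⇔∣ₚproduct h) f∣h!))))

proposition3p1 : ∀ (k : ℕ) (F : FqField k) → let open FqPoly F in
    ((f : List Fq) → Normal f → (a : Fq) → a ≢ 0# →
        ∃ λ g → IsS f g × IsS (a · f) g)
    × ((f : List Fq) → Normal f → f ≢ [] →
        ∃ λ g → IsS f g × g ≼ tpow (deg f))
    × ((f : List Fq) → Irreducible f → IsS f (tpow (deg f)))
proposition3p1 _ F = S-scale F , S≼tpow-deg F , S-irreducible F
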